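{- If $P$ and $Q$ are both $\mathbf{R1}$-healthy and $\mathbf{R2}_c$-healthy, then $\mathbf{R1}(\mathbf{R2}_c(P \,;\, Q)) = P \,;\, Q$.
   Context: Fix a trace algebra $(\mathcal{T}, \frown, \langle\rangle)$: a set with associative $\frown$, two-sided unit $\langle\rangle$, left and right cancellation, and $x \frown y = \langle\rangle \Rightarrow x = \langle\rangle$. Prefix: $x \le y \iff \exists z.\ y = x \frown z$; subtraction: $y - x$ is the unique $z$ with $y = x \frown z$ if $x \le y$, else $\langle\rangle$. Predicates are relations (formulas identified up to logical equivalence) over unprimed variables $v$ and primed variables $v'$, including $tr, tr' : \mathcal{T}$ and other state variables. Sequential composition: $P \,;\, Q \triangleq \exists v_0.\ P[v_0/v'] \land Q[v_0/v]$. Conditional: $P \lhd b \rhd Q \triangleq (b \land P) \lor (\lnot b \land Q)$. $\mathbf{R1}(P) \triangleq P \land tr \le tr'$; $\mathbf{R2}_c(P) \triangleq P[\langle\rangle, tr' - tr / tr, tr'] \lhd tr \le tr' \rhd P$. A predicate $P$ is $\mathbf{H}$-healthy if $\mathbf{H}(P) = P$. -}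

module Defs where

open import Level using (0ℓ)
open import Data.Product using (Σ; ∃; _×_; _,_)
open import Data.Sum using (_⊎_)
open import Relation.Nullary using (¬_)
open import Relation.Binary.PropositionalEquality using (_≡_)
open import Function.Bundles using (_⇔_)

-- A trace algebra (T, ⌢, ⟨⟩), together with the subtraction operation
-- specified as in the paper: y - x is the unique z with y = x ⌢ z when x ≤ y,
-- and ⟨⟩ otherwise.  (Uniqueness follows from left cancellation.)
record TraceAlgebra : Set₁ where
  infixr 6 _⌢_
  infix 4 _≼_
  infixl 6 _-ₜ_
  field
    Carrier  : Set
    _⌢_      : Carrier → Carrier → Carrier
    ⟨⟩       : Carrier
    assoc    : ∀ x y z → (x ⌢ y) ⌢ z ≡ x ⌢ (y ⌢ z)
    identityˡ : ∀ x → ⟨⟩ ⌢ x ≡ x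
    identityʳ : ∀ x → x ⌢ ⟨⟩ ≡ x
    cancelˡ  : ∀ x y z → x ⌢ y ≡ x ⌢ z → y ≡ z
    cancelʳ  : ∀ x y z → x ⌢ z ≡ y ⌢ z → x ≡ y
    nonInv   : ∀ x y → x ⌢ y ≡ ⟨⟩ → x ≡ ⟨⟩

  _≼_ : Carrier → Carrier → Set
  x ≼ y = ∃ λ z → y ≡ x ⌢ z

  field
    _-ₜ_     : Carrier → Carrier → Carrier
    sub-≼    : ∀ x y → x ≼ y → y ≡ x ⌢ (y -ₜ x)
    sub-≰    : ∀ x y → ¬ (x ≼ y) → y -ₜ x ≡ ⟨⟩

module Predicates (𝒯 : TraceAlgebra) (S : Set) where
  open TraceAlgebra 𝒯

  Obs : Set
  Obs = Carrier × S

  -- A predicate relates unprimed variables (tr, s) to primed ones (tr', s').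
  Pred : Set₁
  Pred = Carrier → S → Carrier → S → Set

  _≐_ : Pred → Pred → Set
  P ≐ Q = ∀ tr s tr' s' → P tr s tr' s' ⇔ Q tr s tr' s'

  _⨾_ : Pred → Pred → Pred
  (P ⨾ Q) tr s tr' s' = Σ Carrier λ tr₀ → Σ S λ s₀ → P tr s tr₀ s₀ × Q tr₀ s₀ tr' s'

  cond : Pred → (Carrier → S → Carrier → S → Set) → Pred → Pred
  cond P b Q tr s tr' s' = (b tr s tr' s' × P tr s tr' s') ⊎ (¬ b tr s tr' s' × Q tr s tr' s')

  R1 : Pred → Pred
  R1 P tr s tr' s' = P tr s tr' s' × tr ≼ tr'

  R2c : Pred → Pred
  R2c P = cond (λ tr s tr' s' → P ⟨⟩ s (tr' -ₜ tr) s')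
               (λ tr s tr' s' → tr ≼ tr')
               P

  Healthy : (Pred → Pred) → Pred → Set
  Healthy H P = H P ≐ P

-- R1 says that the trace only grows, and for such predicates R2c says that
-- the behaviour from tr to tr ⌢ d depends on d alone (shift invariance).
-- Both properties survive sequential composition, since an extension of an
-- extension is an extension of the concatenated differences; and R1 ∘ R2c
-- fixes every predicate enjoying both.
module Submission where

open import Defs
open import Data.Product using (_,_)
open import Data.Sum using (inj₁; inj₂)
open import Data.Empty using (⊥-elim)
open import Function.Bundles using (_⇔_; mk⇔; Equivalence)
open import Relation.Binary.PropositionalEquality
  using (_≡_; refl; sym; trans; subst)

module TraceProperties (𝒯 : TraceAlgebra) where
  open TraceAlgebra 𝒯

  x⌢z-ₜx≡z : ∀ x z → (x ⌢ z) -ₜ x ≡ z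
  x⌢z-ₜx≡z x z = cancelˡ x _ _ (sym (sub-≼ x (x ⌢ z) (z , refl)))

  ≼-trans : ∀ {x y z} → x ≼ y → y ≼ z → x ≼ z
  ≼-trans {x} (a , refl) (b , refl) = a ⌢ b , assoc x a b

module PredicateProperties (𝒯 : TraceAlgebra) (S : Set) where
  open TraceAlgebra 𝒯
  open TraceProperties 𝒯
  open Predicates 𝒯 S

  TraceExtending : Pred → Set
  TraceExtending P = ∀ {tr s tr' s'} → P tr s tr' s' → tr ≼ tr'

  ShiftInvariant : Pred → Set
  ShiftInvariant P = ∀ tr s d s' → P tr s (tr ⌢ d) s' ⇔ P ⟨⟩ s d s'

  R1-healthy⇒extending : ∀ {P} → Healthy R1 P → TraceExtending P
  R1-healthy⇒extending h {tr} {s} {tr'} {s'} p with Equivalence.from (h tr s tr' s') p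
  ... | _ , tr≼tr' = tr≼tr'

  R2c-healthy⇒shiftInvariant : ∀ {P} → Healthy R2c P → ShiftInvariant P
  R2c-healthy⇒shiftInvariant {P} h tr s d s' = mk⇔ shift unshift
    where
    shift : P tr s (tr ⌢ d) s' → P ⟨⟩ s d s'
    shift p with Equivalence.from (h tr s (tr ⌢ d) s') p
    ... | inj₁ (_ , p₀) = subst (λ t → P ⟨⟩ s t s') (x⌢z-ₜx≡z tr d) p₀
    ... | inj₂ (tr⋠tr' , _) = ⊥-elim (tr⋠tr' (d , refl))

    unshift : P ⟨⟩ s d s' → P tr s (tr ⌢ d) s'
    unshift p₀ = Equivalence.to (h tr s (tr ⌢ d) s')
      (inj₁ ((d , refl) , subst (λ t → P ⟨⟩ s t s') (sym (x⌢z-ₜx≡z tr d)) p₀))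

  ⨾-extending : ∀ {P Q} → TraceExtending P → TraceExtending Q → TraceExtending (P ⨾ Q)
  ⨾-extending extP extQ (_ , _ , p , q) = ≼-trans (extP p) (extQ q)

  ⨾-shiftInvariant : ∀ {P Q} → TraceExtending P → TraceExtending Q →
                     ShiftInvariant P → ShiftInvariant Q → ShiftInvariant (P ⨾ Q)
  ⨾-shiftInvariant {P} {Q} extP extQ invP invQ tr s d s' = mk⇔ shift unshift
    where
    shift : (P ⨾ Q) tr s (tr ⌢ d) s' → (P ⨾ Q) ⟨⟩ s d s'
    shift (_ , s₀ , p , q) with extP p
    ... | a , refl with extQ q
    ... | b , e = a , s₀ , p₀ , q₀
      where
      p₀ : P ⟨⟩ s a s₀
      p₀ = Equivalence.to (invP tr s a s₀) p

      d≡a⌢b : d ≡ a ⌢ b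
      d≡a⌢b = cancelˡ tr _ _ (trans e (assoc tr a b))

      q₀ : Q a s₀ d s'
      q₀ = subst (λ t → Q a s₀ t s') (sym d≡a⌢b)
             (Equivalence.from (invQ a s₀ b s')
               (Equivalence.to (invQ (tr ⌢ a) s₀ b s')
                 (subst (λ t → Q (tr ⌢ a) s₀ t s') e q)))

    unshift : (P ⨾ Q) ⟨⟩ s d s' → (P ⨾ Q) tr s (tr ⌢ d) s'
    unshift (m , s₀ , p , q) with extQ q
    ... | c , refl = tr ⌢ m , s₀ , p' , q'
      where
      p' : P tr s (tr ⌢ m) s₀
      p' = Equivalence.from (invP tr s m s₀) p

      q' : Q (tr ⌢ m) s₀ (tr ⌢ (m ⌢ c)) s'
      q' = subst (λ t → Q (tr ⌢ m) s₀ t s') (assoc tr m c)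
             (Equivalence.from (invQ (tr ⌢ m) s₀ c s') (Equivalence.to (invQ m s₀ c s') q))

  R1∘R2c-fixes : ∀ {P} → TraceExtending P → ShiftInvariant P → R1 (R2c P) ≐ P
  R1∘R2c-fixes {P} ext inv tr s tr' s' = mk⇔ to from
    where
    to : R1 (R2c P) tr s tr' s' → P tr s tr' s'
    to (inj₁ ((d , refl) , p₀) , _) =
      Equivalence.from (inv tr s d s') (subst (λ t → P ⟨⟩ s t s') (x⌢z-ₜx≡z tr d) p₀)
    to (inj₂ (tr⋠tr' , _) , tr≼tr') = ⊥-elim (tr⋠tr' tr≼tr')

    from : P tr s tr' s' → R1 (R2c P) tr s tr' s'
    from p with ext p
    ... | d , refl = inj₁ ((d , refl) , p₀) , (d , refl)
      where
      p₀ : P ⟨⟩ s ((tr ⌢ d) -ₜ tr) s'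
      p₀ = subst (λ t → P ⟨⟩ s t s') (sym (x⌢z-ₜx≡z tr d)) (Equivalence.to (inv tr s d s') p)

theorem12 : (𝒯 : TraceAlgebra) (S : Set) →
    let open Predicates 𝒯 S in
    (P Q : Pred) →
    Healthy R1 P → Healthy R2c P →
    Healthy R1 Q → Healthy R2c Q →
    R1 (R2c (P ⨾ Q)) ≐ (P ⨾ Q)
theorem12 𝒯 S P Q r1P r2P r1Q r2Q =
  R1∘R2c-fixes (⨾-extending {P} {Q} extP extQ)
               (⨾-shiftInvariant {P} {Q} extP extQ (R2c-healthy⇒shiftInvariant r2P)
                                                   (R2c-healthy⇒shiftInvariant r2Q))
  where
  open PredicateProperties 𝒯 S
  extP : TraceExtending P
  extP = R1-healthy⇒extending r1P

  extQ : TraceExtending Q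
  extQ = R1-healthy⇒extending r1Q
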